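{- Let $p$ be an odd prime. Then there exists a regular quaternary Hadamard matrix of order $p^2+1$ with row sum $p+i$.
   Context: A quaternary Hadamard matrix of order $n$ is an $n\times n$ matrix $H$ with entries in $\{1,-1,i,-i\}$ such that $HH^*=nI_n$, where $H^*$ is the conjugate transpose. It is regular if all its row sums are equal to the same complex number (called its row sum). -}

module Defs where

open import Data.Nat using (ℕ; zero; suc)
open import Data.Integer using (ℤ; +_; 0ℤ; 1ℤ; -1ℤ) renaming (_+_ to _+ℤ_; _*_ to _*ℤ_; -_ to -ℤ_; _-_ to _-ℤ_)
open import Data.Fin using (Fin; zero; suc)
open import Data.Product using (_×_; _,_)
open import Relation.Binary.PropositionalEquality using (_≡_)
open import Relation.Nullary using (yes; no)
open import Data.Fin using (_≟_)

record ℤ[i] : Set where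
  constructor _+_i
  field
    re : ℤ
    im : ℤ
open ℤ[i] public

0ᵍ : ℤ[i]
0ᵍ = 0ℤ + 0ℤ i

_+ᵍ_ : ℤ[i] → ℤ[i] → ℤ[i]
(a + b i) +ᵍ (c + d i) = (a +ℤ c) + (b +ℤ d) i

_*ᵍ_ : ℤ[i] → ℤ[i] → ℤ[i]
(a + b i) *ᵍ (c + d i) = ((a *ℤ c) -ℤ (b *ℤ d)) + ((a *ℤ d) +ℤ (b *ℤ c)) i

conj : ℤ[i] → ℤ[i]
conj (a + b i) = a + (-ℤ b) i

ℕ→ᵍ : ℕ → ℤ[i]
ℕ→ᵍ n = (+ n) + 0ℤ i

Σᵍ : (n : ℕ) → (Fin n → ℤ[i]) → ℤ[i]
Σᵍ zero    f = 0ᵍ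
Σᵍ (suc n) f = f zero +ᵍ Σᵍ n (λ k → f (suc k))

data Q4 : Set where
  one minus-one i-unit minus-i : Q4

⟦_⟧ : Q4 → ℤ[i]
⟦ one ⟧      = 1ℤ + 0ℤ i
⟦ minus-one ⟧ = -1ℤ + 0ℤ i
⟦ i-unit ⟧   = 0ℤ + 1ℤ i
⟦ minus-i ⟧  = 0ℤ + -1ℤ i

QMatrix : ℕ → Set
QMatrix n = Fin n → Fin n → Q4

I : (n : ℕ) → Fin n → Fin n → ℤ[i]
I n r c with r ≟ c
... | yes _ = 1ℤ + 0ℤ i
... | no _  = 0ᵍ

HH* : {n : ℕ} → QMatrix n → Fin n → Fin n → ℤ[i]
HH* {n} H r c = Σᵍ n (λ k → ⟦ H r k ⟧ *ᵍ conj ⟦ H c k ⟧)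

_·ᴹ_ : {n : ℕ} → ℤ[i] → (Fin n → Fin n → ℤ[i]) → Fin n → Fin n → ℤ[i]
(s ·ᴹ M) r c = s *ᵍ M r c

IsQuaternaryHadamard : (n : ℕ) → QMatrix n → Set
IsQuaternaryHadamard n H = ∀ r c → HH* H r c ≡ (ℕ→ᵍ n ·ᴹ I n) r c

IsRegularWithRowSum : (n : ℕ) → QMatrix n → ℤ[i] → Set
IsRegularWithRowSum n H s = ∀ r → Σᵍ n (λ k → ⟦ H r k ⟧) ≡ s

-- Let q = (p − 1)/2 and, in the affine plane over ℤ/p, take the q + 1 parallel
-- classes of slopes 0, …, q; let A x z count the classes in which x and z are
-- collinear. Lines of one class partition the plane and lines of different
-- classes meet in exactly one point, so A² = q(q + 1) J + p A, and hence
-- S = 2A − J − pI is a symmetric ±1 matrix with zero diagonal, S J = 0 and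
-- S² = p² I − J. Bordering S by a row and a column of ones gives a symmetric
-- conference matrix of order p² + 1. Switching it by the vector d that is −1
-- exactly on the q horizontal lines of ordinate < q makes every row sum p, and
-- for a symmetric conference matrix M the matrix M + iI is quaternary Hadamard.

module Submission where

open import Data.Nat as ℕ using (ℕ; zero; suc; _⊓_)
import Data.Nat.Properties as ℕP
open import Data.Nat.DivMod using (m≡m%n+[m/n]*n; m/n≤m; m<n⇒m%n≡m)
import Data.Nat.Divisibility as ℕD
open import Data.Nat.Primality using (Prime; prime⇒nonZero; prime⇒nonTrivial; euclidsLemma; prime⇒irreducible)
open import Data.Nat.Coprimality using (Coprime; coprime-Bézout)
open import Data.Nat.GCD using (module Bézout)
open import Data.Integer as ℤ using (ℤ; +_; 0ℤ; 1ℤ; -1ℤ; _+_; _*_; _-_; -_)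
import Data.Integer.Properties as ℤP
open import Data.Integer.Divisibility.Signed using (_∣_; divides; _∣?_; ∣ᵤ⇒∣; ∣⇒∣ᵤ; ∣m⇒∣-m; ∣m∣n⇒∣m+n; ∣m∣n⇒∣m-n; ∣n⇒∣m*n)
open import Data.Integer.DivMod using (_%ℕ_; _/ℕ_; n%ℕd<d; a≡a%ℕn+[a/ℕn]*n)
open import Data.Integer.Tactic.RingSolver using (solve-∀)
open import Data.Fin as Fin using (Fin; zero; suc; toℕ; _↑ˡ_; _↑ʳ_; combine)
import Data.Fin.Properties as FinP
open import Data.Vec.Functional using (_∷_)
open import Data.Product using (Σ; ∃; _×_; _,_; proj₁; proj₂)
open import Data.Sum as Sum using (_⊎_; inj₁; inj₂)
open import Data.Empty using (⊥; ⊥-elim)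
open import Function using (_∘_; case_of_)
open import Level using (0ℓ)
open import Relation.Nullary using (Dec; yes; no; ¬_)
open import Relation.Nullary.Negation using (contradiction)
open import Relation.Unary using (Pred; Decidable)
open import Relation.Binary.PropositionalEquality
open ≡-Reasoning

open import Algebra.Properties.Semiring.Sum ℤP.+-*-semiring
  using (sum; sum-syntax; sum-cong-≗; ∑-distrib-+; ∑-comm; *-distribˡ-sum; *-distribʳ-sum)

-- Indicators and finite sums over ℤ

𝟙 : {A : Set} → Dec A → ℤ
𝟙 (yes _) = 1ℤ
𝟙 (no _)  = 0ℤ

𝟙-yes : ∀ {A : Set} (a? : Dec A) → A → 𝟙 a? ≡ 1ℤ
𝟙-yes (yes _) _ = refl
𝟙-yes (no ¬a) a = ⊥-elim (¬a a)

𝟙-no : ∀ {A : Set} (a? : Dec A) → ¬ A → 𝟙 a? ≡ 0ℤ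
𝟙-no (yes a) ¬a = ⊥-elim (¬a a)
𝟙-no (no _)  _  = refl

𝟙-idem : ∀ {A : Set} (a? : Dec A) → 𝟙 a? * 𝟙 a? ≡ 𝟙 a?
𝟙-idem (yes _) = refl
𝟙-idem (no _)  = refl

𝟙-cong : ∀ {A B : Set} (a? : Dec A) (b? : Dec B) → (A → B) → (B → A) → 𝟙 a? ≡ 𝟙 b?
𝟙-cong (yes a) b? f g = sym (𝟙-yes b? (f a))
𝟙-cong (no ¬a) b? f g = sym (𝟙-no b? (¬a ∘ g))

𝟙-*-disjoint : ∀ {A B : Set} (a? : Dec A) (b? : Dec B) → (A → B → ⊥) → 𝟙 a? * 𝟙 b? ≡ 0ℤ
𝟙-*-disjoint (yes a) (yes b) disj = ⊥-elim (disj a b)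
𝟙-*-disjoint (yes _) (no _)  _    = refl
𝟙-*-disjoint (no _)  (yes _) _    = refl
𝟙-*-disjoint (no _)  (no _)  _    = refl

δ : ∀ {n} → Fin n → Fin n → ℤ
δ i j = 𝟙 (i Fin.≟ j)

δ-sym : ∀ {n} (i j : Fin n) → δ i j ≡ δ j i
δ-sym i j = 𝟙-cong (i Fin.≟ j) (j Fin.≟ i) sym sym

δ-refl : ∀ {n} (i : Fin n) → δ i i ≡ 1ℤ
δ-refl i = 𝟙-yes (i Fin.≟ i) refl

δ-≢ : ∀ {n} {i j : Fin n} → i ≢ j → δ i j ≡ 0ℤ
δ-≢ {i = i} {j} = 𝟙-no (i Fin.≟ j)

∑-const : ∀ n c → ∑[ i < n ] c ≡ + n * c
∑-const zero    c = sym (ℤP.*-zeroˡ c)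
∑-const (suc n) c = begin
  c + ∑[ i < n ] c  ≡⟨ cong (_+_ c) (∑-const n c) ⟩
  c + + n * c       ≡⟨ ring c (+ n) ⟩
  + suc n * c       ∎
  where
  ring : ∀ c n → c + n * c ≡ (1ℤ + n) * c
  ring = solve-∀

∑-zero : ∀ n → ∑[ i < n ] 0ℤ ≡ 0ℤ
∑-zero n = trans (∑-const n 0ℤ) (ℤP.*-zeroʳ (+ n))

∑-*ˡ : ∀ {n} c (f : Fin n → ℤ) → ∑[ i < n ] (c * f i) ≡ c * sum f
∑-*ˡ c f = sym (*-distribˡ-sum c f)

∑-distrib-- : ∀ {n} (f g : Fin n → ℤ) → ∑[ i < n ] (f i - g i) ≡ sum f - sum g
∑-distrib-- {n} f g = begin
  ∑[ i < n ] (f i - g i)          ≡⟨ sum-cong-≗ (λ i → cong (_+_ (f i)) (sym (ℤP.-1*i≡-i (g i)))) ⟩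
  ∑[ i < n ] (f i + -1ℤ * g i)    ≡⟨ ∑-distrib-+ f (λ i → -1ℤ * g i) ⟩
  sum f + ∑[ i < n ] (-1ℤ * g i)  ≡⟨ cong (_+_ (sum f)) (∑-*ˡ -1ℤ g) ⟩
  sum f + -1ℤ * sum g             ≡⟨ cong (_+_ (sum f)) (ℤP.-1*i≡-i (sum g)) ⟩
  sum f - sum g                   ∎

∑*∑ : ∀ {m n} (f : Fin m → ℤ) (g : Fin n → ℤ) → sum f * sum g ≡ ∑[ i < m ] ∑[ j < n ] (f i * g j)
∑*∑ {m} f g = trans (*-distribʳ-sum (sum g) f) (sum-cong-≗ {m} (λ i → *-distribˡ-sum (f i) g))

∑-supportedAt : ∀ {n} (f : Fin n → ℤ) i → (∀ j → j ≢ i → f j ≡ 0ℤ) → sum f ≡ f i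
∑-supportedAt {suc n} f zero    f≡0 = begin
  f zero + ∑[ j < n ] f (suc j)  ≡⟨ cong (_+_ (f zero)) (trans (sum-cong-≗ (λ j → f≡0 (suc j) λ ())) (∑-zero n)) ⟩
  f zero + 0ℤ                    ≡⟨ ℤP.+-identityʳ (f zero) ⟩
  f zero                         ∎
∑-supportedAt {suc n} f (suc i) f≡0 = begin
  f zero + ∑[ j < n ] f (suc j)  ≡⟨ cong (_+ ∑[ j < n ] f (suc j)) (f≡0 zero λ ()) ⟩
  0ℤ + ∑[ j < n ] f (suc j)      ≡⟨ ℤP.+-identityˡ _ ⟩
  ∑[ j < n ] f (suc j)           ≡⟨ ∑-supportedAt (f ∘ suc) i (λ j j≢i → f≡0 (suc j) (j≢i ∘ FinP.suc-injective)) ⟩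
  f (suc i)                      ∎

∑-δ : ∀ {n} (i : Fin n) (g : Fin n → ℤ) → ∑[ j < n ] (δ i j * g j) ≡ g i
∑-δ {n} i g = begin
  ∑[ j < n ] (δ i j * g j)  ≡⟨ ∑-supportedAt _ i (λ j j≢i → cong (_* g j) (δ-≢ (j≢i ∘ sym))) ⟩
  δ i i * g i               ≡⟨ cong (_* g i) (δ-refl i) ⟩
  1ℤ * g i                  ≡⟨ ℤP.*-identityˡ (g i) ⟩
  g i                       ∎

∑-except : ∀ {n} (f : Fin n → ℤ) i c → (∀ j → j ≢ i → f j ≡ c) → sum f ≡ + n * c + (f i - c)
∑-except {n} f i c f≡c = begin
  sum f                                          ≡⟨ sum-cong-≗ split ⟩
  ∑[ j < n ] (c + δ i j * (f i - c))             ≡⟨ ∑-distrib-+ (λ _ → c) (λ j → δ i j * (f i - c)) ⟩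
  ∑[ j < n ] c + ∑[ j < n ] (δ i j * (f i - c))  ≡⟨ cong₂ _+_ (∑-const n c) (∑-δ i (λ _ → f i - c)) ⟩
  + n * c + (f i - c)                            ∎
  where
  ring : ∀ c a → a ≡ c + 1ℤ * (a - c)
  ring = solve-∀
  split : ∀ j → f j ≡ c + δ i j * (f i - c)
  split j with i Fin.≟ j
  ... | yes refl = ring c (f i)
  ... | no  i≢j  = sym (trans (cong (_+_ c) (ℤP.*-zeroˡ (f i - c))) (trans (ℤP.+-identityʳ c) (sym (f≡c j (i≢j ∘ sym)))))

∑-𝟙-unique : ∀ {n} {P : Pred (Fin n) 0ℓ} (P? : Decidable P) i → P i → (∀ j → P j → j ≡ i) →
             ∑[ j < n ] 𝟙 (P? j) ≡ 1ℤ
∑-𝟙-unique P? i Pi unique =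
  trans (∑-supportedAt _ i (λ j j≢i → 𝟙-no (P? j) (j≢i ∘ unique j))) (𝟙-yes (P? i) Pi)

∑-𝟙-atMostOne : ∀ {n} {P : Pred (Fin n) 0ℓ} (P? : Decidable P) → (∀ i j → P i → P j → i ≡ j) →
                ∑[ j < n ] 𝟙 (P? j) ≡ 0ℤ ⊎ ∑[ j < n ] 𝟙 (P? j) ≡ 1ℤ
∑-𝟙-atMostOne {zero}  P? atMostOne = inj₁ refl
∑-𝟙-atMostOne {suc n} P? atMostOne with P? zero
... | yes P0 = inj₂ (cong (_+_ 1ℤ) (trans (sum-cong-≗ (λ j → 𝟙-no (P? (suc j)) (λ Pj → FinP.0≢1+n (atMostOne _ _ P0 Pj)))) (∑-zero n)))
... | no _ = Sum.map (trans (ℤP.+-identityˡ _)) (trans (ℤP.+-identityˡ _))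
  (∑-𝟙-atMostOne (P? ∘ suc) (λ i j Pi Pj → FinP.suc-injective (atMostOne _ _ Pi Pj)))

∑-𝟙-< : ∀ n k → ∑[ b < n ] 𝟙 (toℕ b ℕ.<? k) ≡ + (n ⊓ k)
∑-𝟙-< zero    k       = refl
∑-𝟙-< (suc n) zero    = trans (sum-cong-≗ {suc n} (λ b → 𝟙-no (toℕ b ℕ.<? 0) λ ())) (∑-zero (suc n))
∑-𝟙-< (suc n) (suc k) = cong (_+_ 1ℤ) (trans (sum-cong-≗ {n} shift) (∑-𝟙-< n k))
  where
  shift : ∀ b → 𝟙 (toℕ (suc b) ℕ.<? suc k) ≡ 𝟙 (toℕ b ℕ.<? k)
  shift b = 𝟙-cong (toℕ (suc b) ℕ.<? suc k) (toℕ b ℕ.<? k) ℕ.s≤s⁻¹ ℕ.s≤s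

∑-↑ : ∀ m n (f : Fin (m ℕ.+ n) → ℤ) → sum f ≡ ∑[ i < m ] f (i ↑ˡ n) + ∑[ j < n ] f (m ↑ʳ j)
∑-↑ zero    n f = sym (ℤP.+-identityˡ (sum f))
∑-↑ (suc m) n f = trans (cong (_+_ (f zero)) (∑-↑ m n (f ∘ suc))) (sym (ℤP.+-assoc (f zero) _ _))

∑-combine : ∀ m n (f : Fin (m ℕ.* n) → ℤ) → sum f ≡ ∑[ i < m ] ∑[ j < n ] f (combine i j)
∑-combine zero    n f = refl
∑-combine (suc m) n f = trans (∑-↑ n (m ℕ.* n) f) (cong (_+_ (∑[ j < n ] f (j ↑ˡ (m ℕ.* n)))) (∑-combine m n (f ∘ (n ↑ʳ_))))

-- Opened only here: the constructor _+_i makes i unusable as a variable name.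
open import Defs

-- Quaternary Hadamard matrices from symmetric conference matrices

IsSign : ℤ → Set
IsSign v = v ≡ 1ℤ ⊎ v ≡ -1ℤ

IsSign-* : ∀ {u v} → IsSign u → IsSign v → IsSign (u * v)
IsSign-* (inj₁ refl) (inj₁ refl) = inj₁ refl
IsSign-* (inj₁ refl) (inj₂ refl) = inj₂ refl
IsSign-* (inj₂ refl) (inj₁ refl) = inj₂ refl
IsSign-* (inj₂ refl) (inj₂ refl) = inj₁ refl

IsSign⇒square≡1 : ∀ {v} → IsSign v → v * v ≡ 1ℤ
IsSign⇒square≡1 (inj₁ refl) = refl
IsSign⇒square≡1 (inj₂ refl) = refl

record IsSymmetricConference (n : ℕ) (M : Fin n → Fin n → ℤ) : Set where
  field
    symmetric   : ∀ r c → M r c ≡ M c r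
    diagonal    : ∀ r → M r r ≡ 0ℤ
    offDiagonal : ∀ {r c} → r ≢ c → IsSign (M r c)
    orthogonal  : ∀ {r c} → r ≢ c → ∑[ k < n ] (M r k * M c k) ≡ 0ℤ

Σᵍ-re-im : ∀ n (f : Fin n → ℤ[i]) → Σᵍ n f ≡ (∑[ k < n ] re (f k)) + (∑[ k < n ] im (f k)) i
Σᵍ-re-im zero    f = refl
Σᵍ-re-im (suc n) f = cong (f zero +ᵍ_) (Σᵍ-re-im n (f ∘ suc))

Σᵍ-cong : ∀ n {f g : Fin n → ℤ[i]} → (∀ k → f k ≡ g k) → Σᵍ n f ≡ Σᵍ n g
Σᵍ-cong zero    f≡g = refl
Σᵍ-cong (suc n) f≡g = cong₂ _+ᵍ_ (f≡g zero) (Σᵍ-cong n (f≡g ∘ suc))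

Σᵍ-one : ∀ n → Σᵍ n (λ _ → 1ℤ + 0ℤ i) ≡ (+ n) + 0ℤ i
Σᵍ-one zero    = refl
Σᵍ-one (suc n) = cong ((1ℤ + 0ℤ i) +ᵍ_) (Σᵍ-one n)

⟦⟧-unit : ∀ u → ⟦ u ⟧ *ᵍ conj ⟦ u ⟧ ≡ 1ℤ + 0ℤ i
⟦⟧-unit one       = refl
⟦⟧-unit minus-one = refl
⟦⟧-unit i-unit    = refl
⟦⟧-unit minus-i   = refl

scaledIdentity-diag : ∀ n (r : Fin n) → (ℕ→ᵍ n ·ᴹ I n) r r ≡ (+ n) + 0ℤ i
scaledIdentity-diag n r with r Fin.≟ r
... | yes _  = cong₂ _+_i (ring₁ (+ n)) (ring₂ (+ n))
  where
  ring₁ : ∀ a → a * 1ℤ - 0ℤ * 0ℤ ≡ a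
  ring₁ = solve-∀
  ring₂ : ∀ a → a * 0ℤ + 0ℤ * 1ℤ ≡ 0ℤ
  ring₂ = solve-∀
... | no r≢r = ⊥-elim (r≢r refl)

scaledIdentity-offDiag : ∀ n {r c : Fin n} → r ≢ c → (ℕ→ᵍ n ·ᴹ I n) r c ≡ 0ᵍ
scaledIdentity-offDiag n {r} {c} r≢c with r Fin.≟ c
... | yes r≡c = ⊥-elim (r≢c r≡c)
... | no _    = cong₂ _+_i (ring₁ (+ n)) (ring₂ (+ n))
  where
  ring₁ : ∀ a → a * 0ℤ - 0ℤ * 0ℤ ≡ 0ℤ
  ring₁ = solve-∀
  ring₂ : ∀ a → a * 0ℤ + 0ℤ * 0ℤ ≡ 0ℤ
  ring₂ = solve-∀

signQ : ℤ → Q4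
signQ v with v ℤ.≟ 1ℤ
... | yes _ = one
... | no _  = minus-one

⟦signQ⟧ : ∀ {v} → IsSign v → ⟦ signQ v ⟧ ≡ v + 0ℤ i
⟦signQ⟧ (inj₁ refl) = refl
⟦signQ⟧ (inj₂ refl) = refl

-- (M + iI)(M + iI)* = M Mᵀ + I + i (Mᵀ − M), and its diagonal is n because all entries are units.
module _ {n} {M : Fin n → Fin n → ℤ} (conf : IsSymmetricConference n M) where
  open IsSymmetricConference conf

  conference+iI : QMatrix n
  conference+iI r c with r Fin.≟ c
  ... | yes _ = i-unit
  ... | no _  = signQ (M r c)

  ⟦conference+iI⟧ : ∀ r c → ⟦ conference+iI r c ⟧ ≡ M r c + δ r c i
  ⟦conference+iI⟧ r c with r Fin.≟ c
  ... | yes refl = cong (_+ 1ℤ i) (sym (diagonal r))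
  ... | no r≢c   = ⟦signQ⟧ (offDiagonal r≢c)

  private
    H = conference+iI

  conference+iI-diag : ∀ r → HH* H r r ≡ (ℕ→ᵍ n ·ᴹ I n) r r
  conference+iI-diag r = begin
    Σᵍ n (λ k → ⟦ H r k ⟧ *ᵍ conj ⟦ H r k ⟧)  ≡⟨ Σᵍ-cong n (λ k → ⟦⟧-unit (H r k)) ⟩
    Σᵍ n (λ _ → 1ℤ + 0ℤ i)                    ≡⟨ Σᵍ-one n ⟩
    (+ n) + 0ℤ i                              ≡⟨ sym (scaledIdentity-diag n r) ⟩
    (ℕ→ᵍ n ·ᴹ I n) r r                        ∎

  conference+iI-offDiag : ∀ {r c} → r ≢ c → HH* H r c ≡ (ℕ→ᵍ n ·ᴹ I n) r c
  conference+iI-offDiag {r} {c} r≢c = begin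
    Σᵍ n (λ k → ⟦ H r k ⟧ *ᵍ conj ⟦ H c k ⟧)
      ≡⟨ Σᵍ-cong n (λ k → cong₂ (λ a b → a *ᵍ conj b) (⟦conference+iI⟧ r k) (⟦conference+iI⟧ c k)) ⟩
    Σᵍ n (λ k → (M r k + δ r k i) *ᵍ conj (M c k + δ c k i))
      ≡⟨ Σᵍ-re-im n _ ⟩
    (∑[ k < n ] (M r k * M c k - δ r k * - δ c k)) + (∑[ k < n ] (M r k * - δ c k + δ r k * M c k)) i
      ≡⟨ cong₂ _+_i re≡0 im≡0 ⟩
    0ᵍ                                       ≡⟨ sym (scaledIdentity-offDiag n r≢c) ⟩
    (ℕ→ᵍ n ·ᴹ I n) r c                       ∎

    where
    ringRe : ∀ a b u v → a * b - u * - v ≡ a * b + u * v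
    ringRe = solve-∀
    ringIm : ∀ a b u v → a * - v + u * b ≡ u * b - v * a
    ringIm = solve-∀
    re≡0 : ∑[ k < n ] (M r k * M c k - δ r k * - δ c k) ≡ 0ℤ
    re≡0 = begin
      ∑[ k < n ] (M r k * M c k - δ r k * - δ c k)             ≡⟨ sum-cong-≗ (λ k → ringRe (M r k) (M c k) (δ r k) (δ c k)) ⟩
      ∑[ k < n ] (M r k * M c k + δ r k * δ c k)               ≡⟨ ∑-distrib-+ (λ k → M r k * M c k) (λ k → δ r k * δ c k) ⟩
      ∑[ k < n ] (M r k * M c k) + ∑[ k < n ] (δ r k * δ c k)  ≡⟨ cong₂ _+_ (orthogonal r≢c) (∑-δ r (δ c)) ⟩
      0ℤ + δ c r                                               ≡⟨ cong (_+_ 0ℤ) (δ-≢ (r≢c ∘ sym)) ⟩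
      0ℤ                                                       ∎
    im≡0 : ∑[ k < n ] (M r k * - δ c k + δ r k * M c k) ≡ 0ℤ
    im≡0 = begin
      ∑[ k < n ] (M r k * - δ c k + δ r k * M c k)             ≡⟨ sum-cong-≗ (λ k → ringIm (M r k) (M c k) (δ r k) (δ c k)) ⟩
      ∑[ k < n ] (δ r k * M c k - δ c k * M r k)               ≡⟨ ∑-distrib-- (λ k → δ r k * M c k) (λ k → δ c k * M r k) ⟩
      ∑[ k < n ] (δ r k * M c k) - ∑[ k < n ] (δ c k * M r k)  ≡⟨ cong₂ _-_ (∑-δ r (M c)) (∑-δ c (M r)) ⟩
      M c r - M r c                                            ≡⟨ cong (_-_ (M c r)) (symmetric r c) ⟩
      M c r - M c r                                            ≡⟨ ℤP.+-inverseʳ (M c r) ⟩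
      0ℤ                                                       ∎

  conference+iI-hadamard : IsQuaternaryHadamard n H
  conference+iI-hadamard r c = byCases (r Fin.≟ c)
    where
    byCases : Dec (r ≡ c) → HH* H r c ≡ (ℕ→ᵍ n ·ᴹ I n) r c
    byCases (yes refl) = conference+iI-diag r
    byCases (no r≢c)   = conference+iI-offDiag r≢c

  conference+iI-regular : ∀ {s} → (∀ r → ∑[ k < n ] M r k ≡ s) → IsRegularWithRowSum n H (s + 1ℤ i)
  conference+iI-regular {s} rowSum r = begin
    Σᵍ n (λ k → ⟦ H r k ⟧)                     ≡⟨ Σᵍ-cong n (⟦conference+iI⟧ r) ⟩
    Σᵍ n (λ k → M r k + δ r k i)               ≡⟨ Σᵍ-re-im n _ ⟩
    (∑[ k < n ] M r k) + (∑[ k < n ] δ r k) i  ≡⟨ cong₂ _+_i (rowSum r) (∑-𝟙-unique (r Fin.≟_) r refl (λ _ → sym)) ⟩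
    s + 1ℤ i                                   ∎

RegularQuaternaryHadamard : ℕ → ℤ[i] → Set
RegularQuaternaryHadamard n s = Σ (QMatrix n) λ H → IsQuaternaryHadamard n H × IsRegularWithRowSum n H s

conference⇒regularHadamard : ∀ {n} {M : Fin n → Fin n → ℤ} {s} → IsSymmetricConference n M →
                             (∀ r → ∑[ k < n ] M r k ≡ s) → RegularQuaternaryHadamard n (s + 1ℤ i)
conference⇒regularHadamard conf rowSum = conference+iI conf , conference+iI-hadamard conf , conference+iI-regular conf rowSum

switch : ∀ {n} → (Fin n → ℤ) → (Fin n → Fin n → ℤ) → Fin n → Fin n → ℤ
switch e M r c = e r * M r c * e c

switch-conference : ∀ {n} {M : Fin n → Fin n → ℤ} (e : Fin n → ℤ) → (∀ k → IsSign (e k)) →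
                    IsSymmetricConference n M → IsSymmetricConference n (switch e M)
switch-conference {n} {M} e e± conf = record
  { symmetric   = λ r c → trans (cong (λ t → e r * t * e c) (symmetric r c)) (ringSym (e r) (M c r) (e c))
  ; diagonal    = λ r → trans (cong (λ t → e r * t * e r) (diagonal r)) (ringZero (e r))
  ; offDiagonal = λ {r} {c} r≢c → IsSign-* (IsSign-* (e± r) (offDiagonal r≢c)) (e± c)
  ; orthogonal  = orthogonal′
  }
  where
  open IsSymmetricConference conf
  ringSym : ∀ a m b → a * m * b ≡ b * m * a
  ringSym = solve-∀
  ringZero : ∀ a → a * 0ℤ * a ≡ 0ℤ
  ringZero = solve-∀
  ringOrth : ∀ a m b c u → a * m * b * (c * u * b) ≡ a * c * ((b * b) * (m * u))
  ringOrth = solve-∀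
  orthogonal′ : ∀ {r c} → r ≢ c → ∑[ k < n ] (switch e M r k * switch e M c k) ≡ 0ℤ
  orthogonal′ {r} {c} r≢c = begin
    ∑[ k < n ] (e r * M r k * e k * (e c * M c k * e k))  ≡⟨ sum-cong-≗ (λ k → ringOrth (e r) (M r k) (e k) (e c) (M c k)) ⟩
    ∑[ k < n ] (e r * e c * ((e k * e k) * (M r k * M c k)))
      ≡⟨ sum-cong-≗ (λ k → cong (λ t → e r * e c * (t * (M r k * M c k))) (IsSign⇒square≡1 (e± k))) ⟩
    ∑[ k < n ] (e r * e c * (1ℤ * (M r k * M c k)))     ≡⟨ ∑-*ˡ (e r * e c) (λ k → 1ℤ * (M r k * M c k)) ⟩
    e r * e c * ∑[ k < n ] (1ℤ * (M r k * M c k))       ≡⟨ cong (_*_ (e r * e c)) (trans (sum-cong-≗ {n} (λ k → ℤP.*-identityˡ (M r k * M c k))) (orthogonal r≢c)) ⟩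
    e r * e c * 0ℤ                                      ≡⟨ ℤP.*-zeroʳ (e r * e c) ⟩
    0ℤ                                                  ∎

record IsConferenceCore (v : ℕ) (S : Fin v → Fin v → ℤ) : Set where
  field
    symmetric       : ∀ x z → S x z ≡ S z x
    diagonal        : ∀ x → S x x ≡ 0ℤ
    offDiagonal     : ∀ {x z} → x ≢ z → IsSign (S x z)
    rowSum≡0        : ∀ x → ∑[ z < v ] S x z ≡ 0ℤ
    innerProduct≡-1 : ∀ {x y} → x ≢ y → ∑[ z < v ] (S x z * S y z) ≡ -1ℤ

border : ∀ {v} → (Fin v → Fin v → ℤ) → Fin (suc v) → Fin (suc v) → ℤ
border S zero    zero    = 0ℤ
border S zero    (suc _) = 1ℤ
border S (suc _) zero    = 1ℤ
border S (suc x) (suc z) = S x z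

border-conference : ∀ {v} {S : Fin v → Fin v → ℤ} → IsConferenceCore v S → IsSymmetricConference (suc v) (border S)
border-conference {v} {S} core = record
  { symmetric   = symmetric′
  ; diagonal    = diagonal′
  ; offDiagonal = offDiagonal′
  ; orthogonal  = orthogonal′
  }
  where
  open IsConferenceCore core
  symmetric′ : ∀ r c → border S r c ≡ border S c r
  symmetric′ zero    zero    = refl
  symmetric′ zero    (suc _) = refl
  symmetric′ (suc _) zero    = refl
  symmetric′ (suc x) (suc z) = symmetric x z
  diagonal′ : ∀ r → border S r r ≡ 0ℤ
  diagonal′ zero    = refl
  diagonal′ (suc x) = diagonal x
  offDiagonal′ : ∀ {r c} → r ≢ c → IsSign (border S r c)
  offDiagonal′ {zero}  {zero}  0≢0 = ⊥-elim (0≢0 refl)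
  offDiagonal′ {zero}  {suc _} _   = inj₁ refl
  offDiagonal′ {suc _} {zero}  _   = inj₁ refl
  offDiagonal′ {suc x} {suc z} x≢z = offDiagonal (x≢z ∘ cong suc)
  orthogonal′ : ∀ {r c} → r ≢ c → ∑[ k < suc v ] (border S r k * border S c k) ≡ 0ℤ
  orthogonal′ {zero}  {zero}  0≢0 = ⊥-elim (0≢0 refl)
  orthogonal′ {zero}  {suc y} _   = begin
    0ℤ + ∑[ z < v ] (1ℤ * S y z)  ≡⟨ ℤP.+-identityˡ _ ⟩
    ∑[ z < v ] (1ℤ * S y z)       ≡⟨ sum-cong-≗ {v} (λ z → ℤP.*-identityˡ (S y z)) ⟩
    ∑[ z < v ] S y z              ≡⟨ rowSum≡0 y ⟩
    0ℤ                            ∎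
  orthogonal′ {suc x} {zero}  _   = begin
    0ℤ + ∑[ z < v ] (S x z * 1ℤ)  ≡⟨ ℤP.+-identityˡ _ ⟩
    ∑[ z < v ] (S x z * 1ℤ)       ≡⟨ sum-cong-≗ {v} (λ z → ℤP.*-identityʳ (S x z)) ⟩
    ∑[ z < v ] S x z              ≡⟨ rowSum≡0 x ⟩
    0ℤ                            ∎
  orthogonal′ {suc x} {suc y} x≢y = cong (_+_ 1ℤ) (innerProduct≡-1 (x≢y ∘ cong suc))

switch-border-rowSum : ∀ {v} (S : Fin v → Fin v → ℤ) (d : Fin v → ℤ) s → (∀ z → IsSign (d z)) →
                       ∑[ z < v ] d z ≡ s → (∀ x → ∑[ z < v ] (d z * S x z) ≡ s * d x - 1ℤ) →
                       ∀ r → ∑[ k < suc v ] switch (1ℤ ∷ d) (border S) r k ≡ s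
switch-border-rowSum {v} S d s d± ∑d ∑dS zero = begin
  0ℤ + ∑[ z < v ] (1ℤ * d z)  ≡⟨ ℤP.+-identityˡ _ ⟩
  ∑[ z < v ] (1ℤ * d z)       ≡⟨ sum-cong-≗ {v} (λ z → ℤP.*-identityˡ (d z)) ⟩
  ∑[ z < v ] d z              ≡⟨ ∑d ⟩
  s                           ∎
switch-border-rowSum {v} S d s d± ∑d ∑dS (suc x) = begin
  d x * 1ℤ * 1ℤ + ∑[ z < v ] (d x * S x z * d z)    ≡⟨ cong (_+_ (d x * 1ℤ * 1ℤ)) (sum-cong-≗ {v} (λ z → ring₁ (d x) (S x z) (d z))) ⟩
  d x * 1ℤ * 1ℤ + ∑[ z < v ] (d x * (d z * S x z))  ≡⟨ cong (_+_ (d x * 1ℤ * 1ℤ)) (∑-*ˡ (d x) (λ z → d z * S x z)) ⟩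
  d x * 1ℤ * 1ℤ + d x * ∑[ z < v ] (d z * S x z)    ≡⟨ cong (λ t → d x * 1ℤ * 1ℤ + d x * t) (∑dS x) ⟩
  d x * 1ℤ * 1ℤ + d x * (s * d x - 1ℤ)              ≡⟨ ring₂ (d x) s ⟩
  s * (d x * d x)                                   ≡⟨ cong (_*_ s) (IsSign⇒square≡1 (d± x)) ⟩
  s * 1ℤ                                            ≡⟨ ℤP.*-identityʳ s ⟩
  s                                                 ∎
  where
  ring₁ : ∀ a m b → a * m * b ≡ a * (b * m)
  ring₁ = solve-∀
  ring₂ : ∀ a s → a * 1ℤ * 1ℤ + a * (s * a - 1ℤ) ≡ s * (a * a)
  ring₂ = solve-∀

-- Arithmetic modulo a prime and the affine plane over ℤ/p

module ModPrime (p : ℕ) (p-prime : Prime p) where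

  private instance
    p≢0 : ℕ.NonZero p
    p≢0 = prime⇒nonZero p-prime

  P : ℤ
  P = + p

  [p∣_] : ℤ → ℤ
  [p∣ e ] = 𝟙 (P ∣? e)

  [p∣-] : ∀ e → [p∣ - e ] ≡ [p∣ e ]
  [p∣-] e = 𝟙-cong (P ∣? - e) (P ∣? e) (λ p∣-e → subst (P ∣_) (ℤP.neg-involutive e) (∣m⇒∣-m p∣-e)) ∣m⇒∣-m

  p∤1 : ¬ P ∣ 1ℤ
  p∤1 p∣1 = ℕ.nonTrivial⇒≢1 {{prime⇒nonTrivial p-prime}} (ℕD.∣1⇒≡1 (∣⇒∣ᵤ p∣1))

  euclid : ∀ m n → P ∣ m * n → P ∣ m ⊎ P ∣ n
  euclid m n p∣mn = Sum.map ∣ᵤ⇒∣ ∣ᵤ⇒∣ (euclidsLemma ℤ.∣ m ∣ ℤ.∣ n ∣ p-prime (subst (p ℕD.∣_) (ℤP.abs-* m n) (∣⇒∣ᵤ p∣mn)))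

  private
    ordered-residues-≡ : ∀ {b c} → b ℕ.≤ c → c ℕ.< p → P ∣ + b - + c → b ≡ c
    ordered-residues-≡ {b} {c} b≤c c<p p∣b-c = ℕP.≤-antisym b≤c (ℕP.m∸n≡0⇒m≤n c∸b≡0)
      where
      p∣c∸b : p ℕD.∣ c ℕ.∸ b
      p∣c∸b = subst (p ℕD.∣_) (trans (cong ℤ.∣_∣ (ℤP.m-n≡m⊖n b c)) (ℤP.∣⊖∣-≤ b≤c)) (∣⇒∣ᵤ p∣b-c)
      c∸b≡0 : c ℕ.∸ b ≡ 0
      c∸b≡0 = trans (sym (m<n⇒m%n≡m (ℕP.≤-<-trans (ℕP.m∸n≤m c b) c<p))) (ℕD.n∣m⇒m%n≡0 (c ℕ.∸ b) p p∣c∸b)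

  residues-≡ : ∀ {b c} → b ℕ.< p → c ℕ.< p → P ∣ + b - + c → b ≡ c
  residues-≡ {b} {c} b<p c<p p∣b-c with ℕP.≤-total b c
  ... | inj₁ b≤c = ordered-residues-≡ b≤c c<p p∣b-c
  ... | inj₂ c≤b = sym (ordered-residues-≡ c≤b b<p p∣c-b)
    where
    ring : ∀ b c → - (b - c) ≡ c - b
    ring = solve-∀
    p∣c-b : P ∣ + c - + b
    p∣c-b = subst (P ∣_) (ring (+ b) (+ c)) (∣m⇒∣-m p∣b-c)

  Fin-residues-≡ : (b c : Fin p) → P ∣ + toℕ b - + toℕ c → b ≡ c
  Fin-residues-≡ b c p∣b-c = FinP.toℕ-injective (residues-≡ (FinP.toℕ<n b) (FinP.toℕ<n c) p∣b-c)

  private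
    coprime : ∀ {n} → ¬ P ∣ + n → Coprime p n
    coprime p∤n (d∣p , d∣n) with prime⇒irreducible p-prime d∣p
    ... | inj₁ d≡1 = d≡1
    ... | inj₂ refl = contradiction (∣ᵤ⇒∣ d∣n) p∤n

    bézout-in-ℤ : ∀ {b c d e} → 1 ℕ.+ b ℕ.* c ≡ d ℕ.* e → 1ℤ + + b * + c ≡ + d * + e
    bézout-in-ℤ {b} {c} {d} {e} eq = begin
      1ℤ + + b * + c     ≡⟨ cong (_+_ 1ℤ) (ℤP.pos-* b c) ⟨
      1ℤ + + (b ℕ.* c)   ≡⟨ ℤP.pos-+ 1 (b ℕ.* c) ⟨
      + (1 ℕ.+ b ℕ.* c)  ≡⟨ cong +_ eq ⟩
      + (d ℕ.* e)        ≡⟨ ℤP.pos-* d e ⟩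
      + d * + e          ∎

    inverse-ℕ : ∀ n → ¬ P ∣ + n → ∃ λ u → P ∣ + n * u - 1ℤ
    inverse-ℕ n p∤n with coprime-Bézout (coprime p∤n)
    ... | Bézout.+- x y 1+yn≡xp = - + y , divides (- + x) (begin
      + n * - + y - 1ℤ    ≡⟨ ring₁ (+ n) (+ y) ⟩
      - (1ℤ + + y * + n)  ≡⟨ cong -_ (bézout-in-ℤ {y} {n} {x} {p} 1+yn≡xp) ⟩
      - (+ x * P)         ≡⟨ ℤP.neg-distribˡ-* (+ x) P ⟩
      - + x * P           ∎)
      where
      ring₁ : ∀ n y → n * - y - 1ℤ ≡ - (1ℤ + y * n)
      ring₁ = solve-∀
    ... | Bézout.-+ x y 1+xp≡yn = + y , divides (+ x) (begin
      + n * + y - 1ℤ     ≡⟨ cong (_- 1ℤ) (ℤP.*-comm (+ n) (+ y)) ⟩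
      + y * + n - 1ℤ     ≡⟨ cong (_- 1ℤ) (bézout-in-ℤ {x} {p} {y} {n} 1+xp≡yn) ⟨
      1ℤ + + x * P - 1ℤ  ≡⟨ ring₂ (+ x * P) ⟩
      + x * P            ∎)
      where
      ring₂ : ∀ a → 1ℤ + a - 1ℤ ≡ a
      ring₂ = solve-∀

  inverse : ∀ k → ¬ P ∣ k → ∃ λ u → P ∣ k * u - 1ℤ
  inverse k p∤k with inverse-ℕ ℤ.∣ k ∣ (p∤k ∘ ∣ᵤ⇒∣ ∘ ∣⇒∣ᵤ) | ℤP.+∣i∣≡i⊎+∣i∣≡-i k
  ... | u , p∣∣k∣u-1 | inj₁ ∣k∣≡k  = u , subst (λ t → P ∣ t * u - 1ℤ) ∣k∣≡k p∣∣k∣u-1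
  ... | u , p∣∣k∣u-1 | inj₂ ∣k∣≡-k = - u , subst (P ∣_) (trans (cong (λ t → t * u - 1ℤ) ∣k∣≡-k) (ring k u)) p∣∣k∣u-1
    where
    ring : ∀ k u → - k * u - 1ℤ ≡ k * - u - 1ℤ
    ring = solve-∀

  residue : ℤ → Fin p
  residue c = Fin.fromℕ< (n%ℕd<d c p)

  p∣residue-c : ∀ c → P ∣ + toℕ (residue c) - c
  p∣residue-c c = divides (- (c /ℕ p)) (begin
    + toℕ (residue c) - c                   ≡⟨ cong (λ r → + r - c) (FinP.toℕ-fromℕ< (n%ℕd<d c p)) ⟩
    + (c %ℕ p) - c                          ≡⟨ cong (_-_ (+ (c %ℕ p))) (a≡a%ℕn+[a/ℕn]*n c p) ⟩
    + (c %ℕ p) - (+ (c %ℕ p) + c /ℕ p * P)  ≡⟨ ring (+ (c %ℕ p)) (c /ℕ p) P ⟩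
    - (c /ℕ p) * P                          ∎)
    where
    ring : ∀ r q p → r - (r + q * p) ≡ - q * p
    ring = solve-∀

  solution-unique : ∀ {k c} → ¬ P ∣ k → (a b : Fin p) → P ∣ k * + toℕ a - c → P ∣ k * + toℕ b - c → a ≡ b
  solution-unique {k} {c} p∤k a b p∣ka-c p∣kb-c =
    Fin-residues-≡ a b (Sum.fromInj₂ (λ p∣k → contradiction p∣k p∤k) (euclid k (+ toℕ a - + toℕ b) p∣k[a-b]))
    where
    ring : ∀ k a b c → (k * a - c) - (k * b - c) ≡ k * (a - b)
    ring = solve-∀
    p∣k[a-b] : P ∣ k * (+ toℕ a - + toℕ b)
    p∣k[a-b] = subst (P ∣_) (ring k (+ toℕ a) (+ toℕ b) c) (∣m∣n⇒∣m-n p∣ka-c p∣kb-c)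

  solution-exists : ∀ {k} c → ¬ P ∣ k → ∃ λ (a : Fin p) → P ∣ k * + toℕ a - c
  solution-exists {k} c p∤k = fromInverse (inverse k p∤k)
    where
    ring : ∀ k a u c → k * (a - u * c) + c * (k * u - 1ℤ) ≡ k * a - c
    ring = solve-∀
    fromInverse : (∃ λ u → P ∣ k * u - 1ℤ) → ∃ λ (a : Fin p) → P ∣ k * + toℕ a - c
    fromInverse (u , p∣ku-1) = residue (u * c) , subst (P ∣_) (ring k (+ toℕ (residue (u * c))) u c)
                                 (∣m∣n⇒∣m+n (∣n⇒∣m*n k (p∣residue-c (u * c))) (∣n⇒∣m*n c p∣ku-1))

  ∑-[p∣k*a-c] : ∀ k c → ¬ P ∣ k → ∑[ a < p ] [p∣ k * + toℕ a - c ] ≡ 1ℤ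
  ∑-[p∣k*a-c] k c p∤k = fromSolution (solution-exists c p∤k)
    where
    fromSolution : (∃ λ (a : Fin p) → P ∣ k * + toℕ a - c) → ∑[ a < p ] [p∣ k * + toℕ a - c ] ≡ 1ℤ
    fromSolution (a₀ , p∣ka₀-c) = ∑-𝟙-unique (λ a → P ∣? k * + toℕ a - c) a₀ p∣ka₀-c
                                    (λ a p∣ka-c → solution-unique p∤k a a₀ p∣ka-c p∣ka₀-c)

  ∑-[p∣a-c] : ∀ c → ∑[ a < p ] [p∣ + toℕ a - c ] ≡ 1ℤ
  ∑-[p∣a-c] c = begin
    ∑[ a < p ] [p∣ + toℕ a - c ]       ≡⟨ sum-cong-≗ {p} (λ a → cong (λ t → [p∣ t - c ]) (ℤP.*-identityˡ (+ toℕ a))) ⟨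
    ∑[ a < p ] [p∣ 1ℤ * + toℕ a - c ]  ≡⟨ ∑-[p∣k*a-c] 1ℤ c p∤1 ⟩
    1ℤ                                 ∎

  ∑-[p∣a-c₁][p∣a-c₂] : ∀ c₁ c₂ → ∑[ a < p ] ([p∣ + toℕ a - c₁ ] * [p∣ + toℕ a - c₂ ]) ≡ [p∣ c₁ - c₂ ]
  ∑-[p∣a-c₁][p∣a-c₂] c₁ c₂ = byCases (P ∣? c₁ - c₂)
    where
    ring₁ : ∀ a c₁ c₂ → (a - c₁) + (c₁ - c₂) ≡ a - c₂
    ring₁ = solve-∀
    ring₂ : ∀ a c₁ c₂ → (a - c₂) - (c₁ - c₂) ≡ a - c₁
    ring₂ = solve-∀
    ring₃ : ∀ a c₁ c₂ → (a - c₂) - (a - c₁) ≡ c₁ - c₂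
    ring₃ = solve-∀
    byCases : (p∣? : Dec (P ∣ c₁ - c₂)) → ∑[ a < p ] ([p∣ + toℕ a - c₁ ] * [p∣ + toℕ a - c₂ ]) ≡ 𝟙 p∣?
    byCases (yes p∣c₁-c₂) = trans (sum-cong-≗ {p} same) (∑-[p∣a-c] c₁)
      where
      same : ∀ a → [p∣ + toℕ a - c₁ ] * [p∣ + toℕ a - c₂ ] ≡ [p∣ + toℕ a - c₁ ]
      same a = trans (cong (_*_ [p∣ + toℕ a - c₁ ]) (sym (𝟙-cong (P ∣? + toℕ a - c₁) (P ∣? + toℕ a - c₂)
                       (λ d → subst (P ∣_) (ring₁ (+ toℕ a) c₁ c₂) (∣m∣n⇒∣m+n d p∣c₁-c₂))
                       (λ d → subst (P ∣_) (ring₂ (+ toℕ a) c₁ c₂) (∣m∣n⇒∣m-n d p∣c₁-c₂)))))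
                     (𝟙-idem (P ∣? + toℕ a - c₁))
    byCases (no p∤c₁-c₂) = trans (sum-cong-≗ {p} disjoint) (∑-zero p)
      where
      disjoint : ∀ a → [p∣ + toℕ a - c₁ ] * [p∣ + toℕ a - c₂ ] ≡ 0ℤ
      disjoint a = 𝟙-*-disjoint (P ∣? + toℕ a - c₁) (P ∣? + toℕ a - c₂)
                     (λ d₁ d₂ → p∤c₁-c₂ (subst (P ∣_) (ring₃ (+ toℕ a) c₁ c₂) (∣m∣n⇒∣m-n d₂ d₁)))

  [p∣b-c]≡δ : ∀ b c → [p∣ + toℕ b - + toℕ c ] ≡ δ b c
  [p∣b-c]≡δ b c = 𝟙-cong (P ∣? + toℕ b - + toℕ c) (b Fin.≟ c) (Fin-residues-≡ b c)
                         (λ { refl → subst (P ∣_) (sym (ℤP.+-inverseʳ (+ toℕ b))) (divides 0ℤ refl) })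

module AffinePlane (p : ℕ) (p-prime : Prime p) where
  open ModPrime p p-prime public

  -- Points are indexed by Fin (p * p), coordinates being read off by remQuot,
  -- so that the core matrix is indexed like a matrix of order p².
  Point : Set
  Point = Fin (p ℕ.* p)

  ξ η : Point → Fin p
  ξ = Fin.quotient {p} p
  η = Fin.remainder {p} p

  X Y : Point → ℤ
  X z = + toℕ (ξ z)
  Y z = + toℕ (η z)

  lineOrdinate : ℤ → Point → ℤ → ℤ
  lineOrdinate s x a = Y x + s * (a - X x)

  OnLine : ℤ → Point → Point → Set
  OnLine s x z = P ∣ Y z - lineOrdinate s x (X z)

  line : ℤ → Point → Point → ℤ
  line s x z = [p∣ Y z - lineOrdinate s x (X z) ]

  ∑-points : ∀ (f : Fin p → Fin p → ℤ) → ∑[ z < p ℕ.* p ] f (ξ z) (η z) ≡ ∑[ a < p ] ∑[ b < p ] f a b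
  ∑-points f = trans (∑-combine p p _) (sum-cong-≗ {p} (λ a → sum-cong-≗ {p} (λ b →
                 cong (λ ab → f (proj₁ ab) (proj₂ ab)) (FinP.remQuot-combine a b))))

  ξη-injective : ∀ {x z} → ξ x ≡ ξ z → η x ≡ η z → x ≡ z
  ξη-injective {x} {z} ξ≡ η≡ = begin
    x                    ≡⟨ FinP.combine-remQuot {p} p x ⟨
    combine (ξ x) (η x)  ≡⟨ cong₂ combine ξ≡ η≡ ⟩
    combine (ξ z) (η z)  ≡⟨ FinP.combine-remQuot {p} p z ⟩
    z                    ∎

  line-refl : ∀ s x → line s x x ≡ 1ℤ
  line-refl s x = 𝟙-yes (P ∣? Y x - lineOrdinate s x (X x)) (divides 0ℤ (ring (Y x) s (X x)))
    where
    ring : ∀ y s x → y - (y + s * (x - x)) ≡ 0ℤ * P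
    ring = solve-∀

  line-sym : ∀ s x z → line s x z ≡ line s z x
  line-sym s x z = trans (cong [p∣_] (ring (Y x) (X x) (Y z) (X z) s)) ([p∣-] (Y x - lineOrdinate s z (X x)))
    where
    ring : ∀ yx xx yz xz s → yz - (yx + s * (xz - xx)) ≡ - (yx - (yz + s * (xx - xz)))
    ring = solve-∀

  ∑-line : ∀ s x → ∑[ z < p ℕ.* p ] line s x z ≡ P
  ∑-line s x = begin
    ∑[ z < p ℕ.* p ] line s x z                                       ≡⟨ ∑-points (λ a b → [p∣ + toℕ b - lineOrdinate s x (+ toℕ a) ]) ⟩
    ∑[ a < p ] ∑[ b < p ] [p∣ + toℕ b - lineOrdinate s x (+ toℕ a) ]  ≡⟨ sum-cong-≗ {p} (λ a → ∑-[p∣a-c] (lineOrdinate s x (+ toℕ a))) ⟩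
    ∑[ a < p ] 1ℤ                                                     ≡⟨ ∑-const p 1ℤ ⟩
    P * 1ℤ                                                            ≡⟨ ℤP.*-identityʳ P ⟩
    P                                                                 ∎

  ∑-line*line : ∀ s t x y → ∑[ z < p ℕ.* p ] (line s x z * line t y z) ≡
                ∑[ a < p ] [p∣ lineOrdinate s x (+ toℕ a) - lineOrdinate t y (+ toℕ a) ]
  ∑-line*line s t x y = trans
    (∑-points (λ a b → [p∣ + toℕ b - lineOrdinate s x (+ toℕ a) ] * [p∣ + toℕ b - lineOrdinate t y (+ toℕ a) ]))
    (sum-cong-≗ {p} (λ a → ∑-[p∣a-c₁][p∣a-c₂] (lineOrdinate s x (+ toℕ a)) (lineOrdinate t y (+ toℕ a))))

  ∑-line*line-parallel : ∀ s x y → ∑[ z < p ℕ.* p ] (line s x z * line s y z) ≡ P * line s x y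
  ∑-line*line-parallel s x y = begin
    ∑[ z < p ℕ.* p ] (line s x z * line s y z)                                ≡⟨ ∑-line*line s s x y ⟩
    ∑[ a < p ] [p∣ lineOrdinate s x (+ toℕ a) - lineOrdinate s y (+ toℕ a) ]  ≡⟨ sum-cong-≗ {p} (λ a → cong [p∣_] (ring (Y x) (X x) (Y y) (X y) s (+ toℕ a))) ⟩
    ∑[ a < p ] [p∣ - (Y y - lineOrdinate s x (X y)) ]                         ≡⟨ ∑-const p _ ⟩
    P * [p∣ - (Y y - lineOrdinate s x (X y)) ]                                ≡⟨ cong (_*_ P) ([p∣-] (Y y - lineOrdinate s x (X y))) ⟩
    P * line s x y                                                            ∎
    where
    ring : ∀ yx xx yy xy s a → (yx + s * (a - xx)) - (yy + s * (a - xy)) ≡ - (yy - (yx + s * (xy - xx)))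
    ring = solve-∀

  ∑-line*line-transversal : ∀ s t x y → ¬ P ∣ s - t → ∑[ z < p ℕ.* p ] (line s x z * line t y z) ≡ 1ℤ
  ∑-line*line-transversal s t x y p∤s-t = begin
    ∑[ z < p ℕ.* p ] (line s x z * line t y z)                                ≡⟨ ∑-line*line s t x y ⟩
    ∑[ a < p ] [p∣ lineOrdinate s x (+ toℕ a) - lineOrdinate t y (+ toℕ a) ]  ≡⟨ sum-cong-≗ {p} (λ a → cong [p∣_] (ring (Y x) (X x) (Y y) (X y) s t (+ toℕ a))) ⟩
    ∑[ a < p ] [p∣ (s - t) * + toℕ a - (Y y - Y x + s * X x - t * X y) ]      ≡⟨ ∑-[p∣k*a-c] (s - t) _ p∤s-t ⟩
    1ℤ                                                                        ∎
    where
    ring : ∀ yx xx yy xy s t a → (yx + s * (a - xx)) - (yy + t * (a - xy)) ≡ (s - t) * a - (yy - yx + s * xx - t * xy)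
    ring = solve-∀

  onTwoLines⇒p∣s-t : ∀ {s t x z} → x ≢ z → OnLine s x z → OnLine t x z → P ∣ s - t
  onTwoLines⇒p∣s-t {s} {t} {x} {z} x≢z on-s on-t = Sum.fromInj₁ vertical (euclid (s - t) (X z - X x) p∣[s-t][Xz-Xx])
    where
    ring₁ : ∀ yx xx yz xz s t → (yz - (yx + t * (xz - xx))) - (yz - (yx + s * (xz - xx))) ≡ (s - t) * (xz - xx)
    ring₁ = solve-∀
    ring₂ : ∀ yx xx yz xz s → (yz - (yx + s * (xz - xx))) + s * (xz - xx) ≡ yz - yx
    ring₂ = solve-∀
    p∣[s-t][Xz-Xx] : P ∣ (s - t) * (X z - X x)
    p∣[s-t][Xz-Xx] = subst (P ∣_) (ring₁ (Y x) (X x) (Y z) (X z) s t) (∣m∣n⇒∣m-n on-t on-s)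
    vertical : P ∣ X z - X x → P ∣ s - t
    vertical p∣Xz-Xx = contradiction (ξη-injective (sym (Fin-residues-≡ (ξ z) (ξ x) p∣Xz-Xx)) (sym (Fin-residues-≡ (η z) (η x) p∣Yz-Yx))) x≢z
      where
      p∣Yz-Yx : P ∣ Y z - Y x
      p∣Yz-Yx = subst (P ∣_) (ring₂ (Y x) (X x) (Y z) (X z) s) (∣m∣n⇒∣m+n on-s (∣n⇒∣m*n s p∣Xz-Xx))

  ∑-weight*horizontalLine : ∀ (w : Fin p → ℤ) x → ∑[ z < p ℕ.* p ] (w (η z) * line 0ℤ x z) ≡ P * w (η x)
  ∑-weight*horizontalLine w x = begin
    ∑[ z < p ℕ.* p ] (w (η z) * line 0ℤ x z)                                   ≡⟨ ∑-points (λ a b → w b * [p∣ + toℕ b - lineOrdinate 0ℤ x (+ toℕ a) ]) ⟩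
    ∑[ a < p ] ∑[ b < p ] (w b * [p∣ + toℕ b - lineOrdinate 0ℤ x (+ toℕ a) ])  ≡⟨ sum-cong-≗ {p} (λ a → trans (sum-cong-≗ {p} (onRow a)) (∑-δ (η x) w)) ⟩
    ∑[ a < p ] w (η x)                                                         ≡⟨ ∑-const p (w (η x)) ⟩
    P * w (η x)                                                                ∎
    where
    ring : ∀ y a x → y + 0ℤ * (a - x) ≡ y
    ring = solve-∀
    onRow : ∀ a b → w b * [p∣ + toℕ b - lineOrdinate 0ℤ x (+ toℕ a) ] ≡ δ (η x) b * w b
    onRow a b = begin
      w b * [p∣ + toℕ b - lineOrdinate 0ℤ x (+ toℕ a) ]  ≡⟨ cong (λ h → w b * [p∣ + toℕ b - h ]) (ring (Y x) (+ toℕ a) (X x)) ⟩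
      w b * [p∣ + toℕ b - Y x ]                          ≡⟨ cong (_*_ (w b)) (trans ([p∣b-c]≡δ b (η x)) (δ-sym b (η x))) ⟩
      w b * δ (η x) b                                    ≡⟨ ℤP.*-comm (w b) (δ (η x) b) ⟩
      δ (η x) b * w b                                    ∎

  ∑-weight*line : ∀ (w : Fin p → ℤ) s x → ¬ P ∣ s → ∑[ z < p ℕ.* p ] (w (η z) * line s x z) ≡ ∑[ b < p ] w b
  ∑-weight*line w s x p∤s = begin
    ∑[ z < p ℕ.* p ] (w (η z) * line s x z)                                   ≡⟨ ∑-points (λ a b → w b * [p∣ + toℕ b - lineOrdinate s x (+ toℕ a) ]) ⟩
    ∑[ a < p ] ∑[ b < p ] (w b * [p∣ + toℕ b - lineOrdinate s x (+ toℕ a) ])  ≡⟨ ∑-comm {p} {p} (λ a b → w b * [p∣ + toℕ b - lineOrdinate s x (+ toℕ a) ]) ⟩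
    ∑[ b < p ] ∑[ a < p ] (w b * [p∣ + toℕ b - lineOrdinate s x (+ toℕ a) ])  ≡⟨ sum-cong-≗ {p} (λ b → trans (∑-*ˡ {p} (w b) _) (cong (_*_ (w b)) (onColumn b))) ⟩
    ∑[ b < p ] (w b * 1ℤ)                                                     ≡⟨ sum-cong-≗ {p} (λ b → ℤP.*-identityʳ (w b)) ⟩
    ∑[ b < p ] w b                                                            ∎
    where
    ring : ∀ b y x s a → b - (y + s * (a - x)) ≡ - (s * a - (b - y + s * x))
    ring = solve-∀
    onColumn : ∀ b → ∑[ a < p ] [p∣ + toℕ b - lineOrdinate s x (+ toℕ a) ] ≡ 1ℤ
    onColumn b = begin
      ∑[ a < p ] [p∣ + toℕ b - lineOrdinate s x (+ toℕ a) ]         ≡⟨ sum-cong-≗ {p} (λ a → cong [p∣_] (ring (+ toℕ b) (Y x) (X x) s (+ toℕ a))) ⟩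
      ∑[ a < p ] [p∣ - (s * + toℕ a - (+ toℕ b - Y x + s * X x)) ]  ≡⟨ sum-cong-≗ {p} (λ a → [p∣-] _) ⟩
      ∑[ a < p ] [p∣ s * + toℕ a - (+ toℕ b - Y x + s * X x) ]      ≡⟨ ∑-[p∣k*a-c] s _ p∤s ⟩
      1ℤ                                                            ∎

-- The net of q + 1 parallel classes

n%2≡1⇒n≡1+[n/2]+[n/2] : ∀ {n} → n ℕ.% 2 ≡ 1 → n ≡ suc (n ℕ./ 2 ℕ.+ n ℕ./ 2)
n%2≡1⇒n≡1+[n/2]+[n/2] {n} n%2≡1 = begin
  n                                  ≡⟨ m≡m%n+[m/n]*n n 2 ⟩
  n ℕ.% 2 ℕ.+ n ℕ./ 2 ℕ.* 2          ≡⟨ cong₂ ℕ._+_ n%2≡1 (ℕP.*-comm (n ℕ./ 2) 2) ⟩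
  suc (n ℕ./ 2 ℕ.+ (n ℕ./ 2 ℕ.+ 0))  ≡⟨ cong (λ t → suc (n ℕ./ 2 ℕ.+ t)) (ℕP.+-identityʳ (n ℕ./ 2)) ⟩
  suc (n ℕ./ 2 ℕ.+ n ℕ./ 2)          ∎

module Net (p : ℕ) (p-prime : Prime p) (p-odd : p ℕ.% 2 ≡ 1) where
  open AffinePlane p p-prime public

  q : ℕ
  q = p ℕ./ 2

  Q : ℤ
  Q = + q

  P≡1+2Q : P ≡ 1ℤ + (Q + Q)
  P≡1+2Q = trans (cong +_ (n%2≡1⇒n≡1+[n/2]+[n/2] p-odd)) (cong (_+_ 1ℤ) (ℤP.pos-+ q q))

  m≡1+Q : + suc q ≡ 1ℤ + Q
  m≡1+Q = ℤP.pos-+ 1 q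

  slope : Fin (suc q) → ℤ
  slope s = + toℕ s

  slope<p : ∀ s → toℕ s ℕ.< p
  slope<p s = subst (toℕ s ℕ.<_) (sym (n%2≡1⇒n≡1+[n/2]+[n/2] p-odd)) (ℕP.<-≤-trans (FinP.toℕ<n s) (ℕ.s≤s (ℕP.m≤m+n q q)))

  slopes-congruent⇒≡ : ∀ {s t} → P ∣ slope s - slope t → s ≡ t
  slopes-congruent⇒≡ {s} {t} p∣s-t = FinP.toℕ-injective (residues-≡ (slope<p s) (slope<p t) p∣s-t)

  -- A = (q + 1) I + the adjacency matrix of the net graph.
  A : Point → Point → ℤ
  A x z = ∑[ s < suc q ] line (slope s) x z

  A-sym : ∀ x z → A x z ≡ A z x
  A-sym x z = sum-cong-≗ {suc q} (λ s → line-sym (slope s) x z)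

  A-diag : ∀ x → A x x ≡ + suc q
  A-diag x = trans (sum-cong-≗ {suc q} (λ s → line-refl (slope s) x)) (trans (∑-const (suc q) 1ℤ) (ℤP.*-identityʳ _))

  A-offDiag : ∀ {x z} → x ≢ z → A x z ≡ 0ℤ ⊎ A x z ≡ 1ℤ
  A-offDiag {x} {z} x≢z = ∑-𝟙-atMostOne (λ s → P ∣? Y z - lineOrdinate (slope s) x (X z))
    (λ s t on-s on-t → slopes-congruent⇒≡ (onTwoLines⇒p∣s-t {slope s} {slope t} x≢z on-s on-t))

  ∑-A : ∀ x → ∑[ z < p ℕ.* p ] A x z ≡ + suc q * P
  ∑-A x = begin
    ∑[ z < p ℕ.* p ] ∑[ s < suc q ] line (slope s) x z  ≡⟨ ∑-comm {p ℕ.* p} {suc q} (λ z s → line (slope s) x z) ⟩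
    ∑[ s < suc q ] ∑[ z < p ℕ.* p ] line (slope s) x z  ≡⟨ sum-cong-≗ {suc q} (λ s → ∑-line (slope s) x) ⟩
    ∑[ s < suc q ] P                                    ≡⟨ ∑-const (suc q) P ⟩
    + suc q * P                                         ∎

  ∑-A*A : ∀ x y → ∑[ z < p ℕ.* p ] (A x z * A y z) ≡ + suc q * Q + P * A x y
  ∑-A*A x y = begin
    ∑[ z < p ℕ.* p ] (A x z * A y z)
      ≡⟨ sum-cong-≗ {p ℕ.* p} (λ z → ∑*∑ (λ s → line (slope s) x z) (λ t → line (slope t) y z)) ⟩
    ∑[ z < p ℕ.* p ] ∑[ s < suc q ] ∑[ t < suc q ] L z s t
      ≡⟨ ∑-comm {p ℕ.* p} {suc q} (λ z s → ∑[ t < suc q ] L z s t) ⟩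
    ∑[ s < suc q ] ∑[ z < p ℕ.* p ] ∑[ t < suc q ] L z s t
      ≡⟨ sum-cong-≗ {suc q} (λ s → ∑-comm {p ℕ.* p} {suc q} (λ z t → L z s t)) ⟩
    ∑[ s < suc q ] ∑[ t < suc q ] ∑[ z < p ℕ.* p ] L z s t
      ≡⟨ sum-cong-≗ {suc q} (λ s → ∑-except (λ t → ∑[ z < p ℕ.* p ] L z s t) s 1ℤ (transversal s)) ⟩
    ∑[ s < suc q ] (+ suc q * 1ℤ + (∑[ z < p ℕ.* p ] L z s s - 1ℤ))
      ≡⟨ sum-cong-≗ {suc q} (λ s → cong₂ (λ m c → m * 1ℤ + (c - 1ℤ)) m≡1+Q (∑-line*line-parallel (slope s) x y)) ⟩
    ∑[ s < suc q ] ((1ℤ + Q) * 1ℤ + (P * line (slope s) x y - 1ℤ))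
      ≡⟨ sum-cong-≗ {suc q} (λ s → ring Q (P * line (slope s) x y)) ⟩
    ∑[ s < suc q ] (Q + P * line (slope s) x y)
      ≡⟨ ∑-distrib-+ (λ _ → Q) (λ s → P * line (slope s) x y) ⟩
    ∑[ s < suc q ] Q + ∑[ s < suc q ] (P * line (slope s) x y)
      ≡⟨ cong₂ _+_ (∑-const (suc q) Q) (∑-*ˡ P (λ s → line (slope s) x y)) ⟩
    + suc q * Q + P * A x y
      ∎
    where
    L : Point → Fin (suc q) → Fin (suc q) → ℤ
    L z s t = line (slope s) x z * line (slope t) y z
    transversal : ∀ s t → t ≢ s → ∑[ z < p ℕ.* p ] L z s t ≡ 1ℤ
    transversal s t t≢s = ∑-line*line-transversal (slope s) (slope t) x y (λ p∣s-t → t≢s (sym (slopes-congruent⇒≡ p∣s-t)))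
    ring : ∀ Q a → (1ℤ + Q) * 1ℤ + (a - 1ℤ) ≡ Q + a
    ring = solve-∀

  seidel : Point → Point → ℤ
  seidel x z = + 2 * A x z - 1ℤ - P * δ x z

  ∑-seidel* : ∀ x (g : Point → ℤ) →
              ∑[ z < p ℕ.* p ] (seidel x z * g z) ≡ + 2 * ∑[ z < p ℕ.* p ] (A x z * g z) - sum g - P * g x
  ∑-seidel* x g = begin
    ∑[ z < p ℕ.* p ] (seidel x z * g z)
      ≡⟨ sum-cong-≗ {p ℕ.* p} (λ z → ring (A x z) (g z) P (δ x z)) ⟩
    ∑[ z < p ℕ.* p ] ((+ 2 * (A x z * g z) - g z) - P * (δ x z * g z))
      ≡⟨ ∑-distrib-- (λ z → + 2 * (A x z * g z) - g z) (λ z → P * (δ x z * g z)) ⟩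
    ∑[ z < p ℕ.* p ] (+ 2 * (A x z * g z) - g z) - ∑[ z < p ℕ.* p ] (P * (δ x z * g z))
      ≡⟨ cong₂ _-_ (∑-distrib-- (λ z → + 2 * (A x z * g z)) g) (∑-*ˡ P (λ z → δ x z * g z)) ⟩
    ∑[ z < p ℕ.* p ] (+ 2 * (A x z * g z)) - sum g - P * ∑[ z < p ℕ.* p ] (δ x z * g z)
      ≡⟨ cong₂ (λ a b → a - sum g - P * b) (∑-*ˡ (+ 2) (λ z → A x z * g z)) (∑-δ x g) ⟩
    + 2 * ∑[ z < p ℕ.* p ] (A x z * g z) - sum g - P * g x
      ∎
    where
    ring : ∀ a g P d → (+ 2 * a - 1ℤ - P * d) * g ≡ (+ 2 * (a * g) - g) - P * (d * g)
    ring = solve-∀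

  seidel-sym : ∀ x z → seidel x z ≡ seidel z x
  seidel-sym x z = cong₂ (λ a d → + 2 * a - 1ℤ - P * d) (A-sym x z) (δ-sym x z)

  seidel-diag : ∀ x → seidel x x ≡ 0ℤ
  seidel-diag x = begin
    + 2 * A x x - 1ℤ - P * δ x x               ≡⟨ cong₂ (λ a d → + 2 * a - 1ℤ - P * d) (trans (A-diag x) m≡1+Q) (δ-refl x) ⟩
    + 2 * (1ℤ + Q) - 1ℤ - P * 1ℤ               ≡⟨ cong (λ P → + 2 * (1ℤ + Q) - 1ℤ - P * 1ℤ) P≡1+2Q ⟩
    + 2 * (1ℤ + Q) - 1ℤ - (1ℤ + (Q + Q)) * 1ℤ  ≡⟨ ring Q ⟩
    0ℤ                                         ∎
    where
    ring : ∀ Q → + 2 * (1ℤ + Q) - 1ℤ - (1ℤ + (Q + Q)) * 1ℤ ≡ 0ℤ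
    ring = solve-∀

  seidel-offDiag : ∀ {x z} → x ≢ z → IsSign (seidel x z)
  seidel-offDiag {x} {z} x≢z = Sum.map (seidel≡ 1ℤ 1ℤ refl) (seidel≡ 0ℤ -1ℤ refl) (Sum.swap (A-offDiag x≢z))
    where
    seidel≡ : ∀ a c → + 2 * a - 1ℤ ≡ c → A x z ≡ a → seidel x z ≡ c
    seidel≡ a c 2a-1≡c A≡a = begin
      + 2 * A x z - 1ℤ - P * δ x z  ≡⟨ cong₂ (λ a d → + 2 * a - 1ℤ - P * d) A≡a (δ-≢ x≢z) ⟩
      + 2 * a - 1ℤ - P * 0ℤ         ≡⟨ cong (_-_ (+ 2 * a - 1ℤ)) (ℤP.*-zeroʳ P) ⟩
      + 2 * a - 1ℤ - 0ℤ             ≡⟨ ℤP.+-identityʳ (+ 2 * a - 1ℤ) ⟩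
      + 2 * a - 1ℤ                  ≡⟨ 2a-1≡c ⟩
      c                             ∎

  ∑-seidel : ∀ x → ∑[ z < p ℕ.* p ] seidel x z ≡ 0ℤ
  ∑-seidel x = begin
    ∑[ z < p ℕ.* p ] seidel x z
      ≡⟨ sum-cong-≗ {p ℕ.* p} (λ z → ℤP.*-identityʳ (seidel x z)) ⟨
    ∑[ z < p ℕ.* p ] (seidel x z * 1ℤ)
      ≡⟨ ∑-seidel* x (λ _ → 1ℤ) ⟩
    + 2 * ∑[ z < p ℕ.* p ] (A x z * 1ℤ) - ∑[ z < p ℕ.* p ] 1ℤ - P * 1ℤ
      ≡⟨ cong₂ (λ a b → + 2 * a - b - P * 1ℤ)
               (trans (sum-cong-≗ {p ℕ.* p} (λ z → ℤP.*-identityʳ (A x z))) (∑-A x))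
               (trans (∑-const (p ℕ.* p) 1ℤ) (cong (_* 1ℤ) (ℤP.pos-* p p))) ⟩
    + 2 * (+ suc q * P) - P * P * 1ℤ - P * 1ℤ
      ≡⟨ cong₂ (λ m P → + 2 * (m * P) - P * P * 1ℤ - P * 1ℤ) m≡1+Q P≡1+2Q ⟩
    + 2 * ((1ℤ + Q) * (1ℤ + (Q + Q))) - (1ℤ + (Q + Q)) * (1ℤ + (Q + Q)) * 1ℤ - (1ℤ + (Q + Q)) * 1ℤ
      ≡⟨ ring Q ⟩
    0ℤ
      ∎
    where
    ring : ∀ Q → + 2 * ((1ℤ + Q) * (1ℤ + (Q + Q))) - (1ℤ + (Q + Q)) * (1ℤ + (Q + Q)) * 1ℤ - (1ℤ + (Q + Q)) * 1ℤ ≡ 0ℤ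
    ring = solve-∀

  ∑-seidel*seidel : ∀ {x y} → x ≢ y → ∑[ z < p ℕ.* p ] (seidel x z * seidel y z) ≡ -1ℤ
  ∑-seidel*seidel {x} {y} x≢y = begin
    ∑[ z < p ℕ.* p ] (seidel x z * seidel y z)
      ≡⟨ ∑-seidel* x (seidel y) ⟩
    + 2 * ∑[ z < p ℕ.* p ] (A x z * seidel y z) - sum (seidel y) - P * seidel y x
      ≡⟨ cong₂ (λ s t → + 2 * s - t - P * seidel y x) ∑-A*seidel (∑-seidel y) ⟩
    + 2 * (+ 2 * (+ suc q * Q + P * a) - + suc q * P - P * a) - 0ℤ - P * seidel y x
      ≡⟨ cong (λ t → + 2 * (+ 2 * (+ suc q * Q + P * a) - + suc q * P - P * a) - 0ℤ - P * t) seidel-yx ⟩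
    + 2 * (+ 2 * (+ suc q * Q + P * a) - + suc q * P - P * a) - 0ℤ - P * (+ 2 * a - 1ℤ - P * 0ℤ)
      ≡⟨ cong₂ (λ m P → + 2 * (+ 2 * (m * Q + P * a) - m * P - P * a) - 0ℤ - P * (+ 2 * a - 1ℤ - P * 0ℤ)) m≡1+Q P≡1+2Q ⟩
    + 2 * (+ 2 * ((1ℤ + Q) * Q + (1ℤ + (Q + Q)) * a) - (1ℤ + Q) * (1ℤ + (Q + Q)) - (1ℤ + (Q + Q)) * a) - 0ℤ
      - (1ℤ + (Q + Q)) * (+ 2 * a - 1ℤ - (1ℤ + (Q + Q)) * 0ℤ)
      ≡⟨ ring Q a ⟩
    -1ℤ
      ∎
    where
    a = A x y
    ∑-A*seidel : ∑[ z < p ℕ.* p ] (A x z * seidel y z) ≡ + 2 * (+ suc q * Q + P * a) - + suc q * P - P * a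
    ∑-A*seidel = begin
      ∑[ z < p ℕ.* p ] (A x z * seidel y z)     ≡⟨ sum-cong-≗ {p ℕ.* p} (λ z → ℤP.*-comm (A x z) (seidel y z)) ⟩
      ∑[ z < p ℕ.* p ] (seidel y z * A x z)     ≡⟨ ∑-seidel* y (A x) ⟩
      + 2 * ∑[ z < p ℕ.* p ] (A y z * A x z) - sum (A x) - P * A x y
        ≡⟨ cong₂ (λ s t → + 2 * s - t - P * a) (trans (∑-A*A y x) (cong (λ b → + suc q * Q + P * b) (A-sym y x))) (∑-A x) ⟩
      + 2 * (+ suc q * Q + P * a) - + suc q * P - P * a  ∎
    seidel-yx : seidel y x ≡ + 2 * a - 1ℤ - P * 0ℤ
    seidel-yx = cong₂ (λ b d → + 2 * b - 1ℤ - P * d) (A-sym y x) (δ-≢ (x≢y ∘ sym))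
    ring : ∀ Q a → + 2 * (+ 2 * ((1ℤ + Q) * Q + (1ℤ + (Q + Q)) * a) - (1ℤ + Q) * (1ℤ + (Q + Q)) - (1ℤ + (Q + Q)) * a) - 0ℤ
                     - (1ℤ + (Q + Q)) * (+ 2 * a - 1ℤ - (1ℤ + (Q + Q)) * 0ℤ) ≡ -1ℤ
    ring = solve-∀

  seidel-core : IsConferenceCore (p ℕ.* p) seidel
  seidel-core = record
    { symmetric       = seidel-sym
    ; diagonal        = seidel-diag
    ; offDiagonal     = seidel-offDiag
    ; rowSum≡0        = ∑-seidel
    ; innerProduct≡-1 = ∑-seidel*seidel
    }

  weight : Fin p → ℤ
  weight b = 1ℤ - + 2 * 𝟙 (toℕ b ℕ.<? q)

  weight-sign : ∀ b → IsSign (weight b)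
  weight-sign b = sign (toℕ b ℕ.<? q)
    where
    sign : ∀ {B : Set} (b? : Dec B) → IsSign (1ℤ - + 2 * 𝟙 b?)
    sign (yes _) = inj₂ refl
    sign (no _)  = inj₁ refl

  ∑-weight : ∑[ b < p ] weight b ≡ 1ℤ
  ∑-weight = begin
    ∑[ b < p ] (1ℤ - + 2 * 𝟙 (toℕ b ℕ.<? q))             ≡⟨ ∑-distrib-- {p} (λ _ → 1ℤ) (λ b → + 2 * 𝟙 (toℕ b ℕ.<? q)) ⟩
    ∑[ b < p ] 1ℤ - ∑[ b < p ] (+ 2 * 𝟙 (toℕ b ℕ.<? q))  ≡⟨ cong₂ _-_ (∑-const p 1ℤ) (∑-*ˡ {p} (+ 2) (λ b → 𝟙 (toℕ b ℕ.<? q))) ⟩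
    P * 1ℤ - + 2 * ∑[ b < p ] 𝟙 (toℕ b ℕ.<? q)           ≡⟨ cong (λ c → P * 1ℤ - + 2 * c) (trans (∑-𝟙-< p q) (cong +_ (ℕP.m≥n⇒m⊓n≡n q≤p))) ⟩
    P * 1ℤ - + 2 * Q                                     ≡⟨ cong (λ P → P * 1ℤ - + 2 * Q) P≡1+2Q ⟩
    (1ℤ + (Q + Q)) * 1ℤ - + 2 * Q                        ≡⟨ ring Q ⟩
    1ℤ                                                   ∎
    where
    q≤p : q ℕ.≤ p
    q≤p = m/n≤m p 2
    ring : ∀ Q → (1ℤ + (Q + Q)) * 1ℤ - + 2 * Q ≡ 1ℤ
    ring = solve-∀

  d : Point → ℤ
  d z = weight (η z)

  ∑-d : ∑[ z < p ℕ.* p ] d z ≡ P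
  ∑-d = begin
    ∑[ z < p ℕ.* p ] weight (η z)   ≡⟨ ∑-points (λ _ b → weight b) ⟩
    ∑[ a < p ] ∑[ b < p ] weight b  ≡⟨ sum-cong-≗ {p} (λ _ → ∑-weight) ⟩
    ∑[ a < p ] 1ℤ                   ≡⟨ ∑-const p 1ℤ ⟩
    P * 1ℤ                          ≡⟨ ℤP.*-identityʳ P ⟩
    P                               ∎

  -- Slope 0 is the horizontal line through x, on which d is constant; a line of any
  -- other slope meets every horizontal line once, so d sums to ∑-weight along it.
  ∑-d*A : ∀ x → ∑[ z < p ℕ.* p ] (d z * A x z) ≡ P * d x + Q
  ∑-d*A x = begin
    ∑[ z < p ℕ.* p ] (d z * A x z)
      ≡⟨ sum-cong-≗ {p ℕ.* p} (λ z → *-distribˡ-sum (d z) (λ s → line (slope s) x z)) ⟩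
    ∑[ z < p ℕ.* p ] ∑[ s < suc q ] (d z * line (slope s) x z)
      ≡⟨ ∑-comm {p ℕ.* p} {suc q} (λ z s → d z * line (slope s) x z) ⟩
    ∑[ z < p ℕ.* p ] (d z * line 0ℤ x z) + ∑[ s < q ] ∑[ z < p ℕ.* p ] (d z * line (slope (suc s)) x z)
      ≡⟨ cong₂ _+_ (∑-weight*horizontalLine weight x) (sum-cong-≗ {q} (λ s → trans (∑-weight*line weight (slope (suc s)) x (p∤slope s)) ∑-weight)) ⟩
    P * d x + ∑[ s < q ] 1ℤ
      ≡⟨ cong (_+_ (P * d x)) (trans (∑-const q 1ℤ) (ℤP.*-identityʳ Q)) ⟩
    P * d x + Q
      ∎
    where
    p∤slope : ∀ s → ¬ P ∣ slope (suc s)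
    p∤slope s p∣s = case slopes-congruent⇒≡ {suc s} {zero} (subst (P ∣_) (sym (ℤP.+-identityʳ (slope (suc s)))) p∣s) of λ ()

  ∑-d*seidel : ∀ x → ∑[ z < p ℕ.* p ] (d z * seidel x z) ≡ P * d x - 1ℤ
  ∑-d*seidel x = begin
    ∑[ z < p ℕ.* p ] (d z * seidel x z)                                       ≡⟨ sum-cong-≗ {p ℕ.* p} (λ z → ℤP.*-comm (d z) (seidel x z)) ⟩
    ∑[ z < p ℕ.* p ] (seidel x z * d z)                                       ≡⟨ ∑-seidel* x d ⟩
    + 2 * ∑[ z < p ℕ.* p ] (A x z * d z) - sum d - P * d x                    ≡⟨ cong₂ (λ s t → + 2 * s - t - P * d x) ∑-A*d ∑-d ⟩
    + 2 * (P * d x + Q) - P - P * d x                                         ≡⟨ cong (λ P → + 2 * (P * d x + Q) - P - P * d x) P≡1+2Q ⟩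
    + 2 * ((1ℤ + (Q + Q)) * d x + Q) - (1ℤ + (Q + Q)) - (1ℤ + (Q + Q)) * d x  ≡⟨ ring Q (d x) ⟩
    (1ℤ + (Q + Q)) * d x - 1ℤ                                                 ≡⟨ cong (λ P → P * d x - 1ℤ) P≡1+2Q ⟨
    P * d x - 1ℤ                                                              ∎
    where
    ∑-A*d : ∑[ z < p ℕ.* p ] (A x z * d z) ≡ P * d x + Q
    ∑-A*d = trans (sum-cong-≗ {p ℕ.* p} (λ z → ℤP.*-comm (A x z) (d z))) (∑-d*A x)
    ring : ∀ Q e → + 2 * ((1ℤ + (Q + Q)) * e + Q) - (1ℤ + (Q + Q)) - (1ℤ + (Q + Q)) * e ≡ (1ℤ + (Q + Q)) * e - 1ℤ
    ring = solve-∀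

  regularHadamard : RegularQuaternaryHadamard (suc (p ℕ.* p)) (P + 1ℤ i)
  regularHadamard = conference⇒regularHadamard
    (switch-conference (1ℤ ∷ d) signs (border-conference seidel-core))
    (switch-border-rowSum seidel d P (weight-sign ∘ η) ∑-d ∑-d*seidel)
    where
    signs : ∀ k → IsSign ((1ℤ ∷ d) k)
    signs zero    = inj₁ refl
    signs (suc z) = weight-sign (η z)

theorem3p3 : (p : ℕ) → Prime p → p ℕ.% 2 ≡ 1 →
    Σ (QMatrix (p ℕ.* p ℕ.+ 1)) λ H →
      IsQuaternaryHadamard (p ℕ.* p ℕ.+ 1) H × IsRegularWithRowSum (p ℕ.* p ℕ.+ 1) H ((+ p) + 1ℤ i)
theorem3p3 p p-prime p-odd = subst (λ n → RegularQuaternaryHadamard n ((+ p) + 1ℤ i)) (ℕP.+-comm 1 (p ℕ.* p))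
  (Net.regularHadamard p p-prime p-odd)
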